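{- Let $f:\mathbb{B}^n\to\mathbb{B}^n$ be a Boolean network in which component $n$ is not autoregulated, and let $\mathrm{D}\in\{\mathrm{AD},\mathrm{GD}\}$. If $A$ is an attractor of $\mathrm{D}(f)$, then the set $(A_{[n-1]})^{\star}=\{x\in\mathbb{B}^n: x_{[n-1]}\in A_{[n-1]}\}$ contains at most one attractor of $\mathrm{D}(f)$.
   Context: $\mathbb{B}=\{0,1\}$, $[n]=\{1,\dots,n\}$. For $x\in\mathbb{B}^n$, $\bar x^i$ is $x$ with coordinate $i$ flipped. Component $i$ regulates $j$ if $f_j(x)\neq f_j(\bar x^i)$ for some $x$; $n$ is autoregulated if it regulates itself. $A_{[n-1]}$ is the projection of $A$ onto the first $n-1$ coordinates. Dynamics are directed graphs on $\mathbb{B}^n$: the asynchronous dynamics $\mathrm{AD}(f)$ has transitions $x\to \bar x^i$ whenever $f_i(x)\neq x_i$; the general asynchronous dynamics $\mathrm{GD}(f)$ has transitions $x\to y$ whenever $y\neq x$ and $y_i\neq x_i\Rightarrow y_i=f_i(x)$ for all $i$. A trap set is a set of states with no transitions leaving it; an attractor is an inclusion-minimal nonempty trap set. -}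

module Defs where

open import Data.Bool using (Bool; not)
open import Data.Nat using (ℕ; suc)
open import Data.Fin using (Fin; fromℕ)
open import Data.Vec using (Vec; lookup; init; _[_]%=_)
open import Data.Product using (Σ; ∃; _×_; _,_)
open import Relation.Binary.PropositionalEquality using (_≡_; _≢_)
open import Relation.Nullary using (¬_)

State : ℕ → Set
State n = Vec Bool n

BN : ℕ → Set
BN n = State n → State n

flip : ∀ {n} → Fin n → State n → State n
flip i x = x [ i ]%= not

Regulates : ∀ {n} → BN n → Fin n → Fin n → Set
Regulates f i j = ∃ λ x → lookup (f x) j ≢ lookup (f (flip i x)) j

StateSet : ℕ → Set₁
StateSet n = State n → Set

_⊆_ : ∀ {n} → StateSet n → StateSet n → Set
A ⊆ B = ∀ x → A x → B x

Nonempty : ∀ {n} → StateSet n → Set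
Nonempty A = ∃ λ x → A x

data Mode : Set where
  AD GD : Mode

Trans : ∀ {n} → Mode → BN n → State n → State n → Set
Trans AD f x y = ∃ λ i → (lookup (f x) i ≢ lookup x i) × (y ≡ flip i x)
Trans GD f x y =
  (y ≢ x) × (∀ i → lookup y i ≢ lookup x i → lookup y i ≡ lookup (f x) i)

TrapSet : ∀ {n} → Mode → BN n → StateSet n → Set
TrapSet D f T = ∀ x y → T x → Trans D f x y → T y

Attractor : ∀ {n} → Mode → BN n → StateSet n → Set₁
Attractor D f A =
  Nonempty A × TrapSet D f A ×
  (∀ (B : StateSet _) → Nonempty B → TrapSet D f B → B ⊆ A → A ⊆ B)

-- (A_[n-1])* for states in 𝔹^(n+1): states whose first n coordinates
-- agree with those of some state of A
Star : ∀ {n} → StateSet (suc n) → StateSet (suc n)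
Star A x = ∃ λ a → A a × (init a ≡ init x)

-- Two attractors that meet coincide, so it suffices that every attractor B inside (A_[n-1])*
-- meets A. A state b ∈ B shares its first n-1 coordinates with some a ∈ A, so b = a or b is a
-- with the last coordinate flipped. In the latter case, either f changes the last coordinate of a,
-- so a → b and b ∈ A; or it does not, and then, as f_n does not depend on x_n, f changes the last
-- coordinate of b, so b → a and a ∈ B.
module Submission where

open import Defs
open import Data.Nat using (ℕ; suc; zero)
open import Data.Fin using (Fin; fromℕ)
open import Data.Fin.Properties using () renaming (_≟_ to _≟ᶠ_)
open import Data.Bool using (Bool; not)
open import Data.Bool.Properties using (not-involutive; not-¬; ¬-not) renaming (_≟_ to _≟ᵇ_)
open import Data.Vec using (Vec; []; _∷_; lookup; init)
open import Data.Vec.Properties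
  using (lookup∘updateAt; lookup∘updateAt′; ∷-injective; updateAt-updateAt; updateAt-id-local)
open import Data.Product using (_×_; _,_; proj₁; proj₂)
open import Data.Sum using (_⊎_; inj₁; inj₂)
open import Relation.Nullary using (¬_; yes; no; contradiction)
open import Relation.Binary.PropositionalEquality

_∩_ : ∀ {n} → StateSet n → StateSet n → StateSet n
(A ∩ B) x = A x × B x

lookup-flip : ∀ {n} (i : Fin n) (x : State n) → lookup (flip i x) i ≡ not (lookup x i)
lookup-flip i x = lookup∘updateAt i x

flip-involutive : ∀ {n} (i : Fin n) (x : State n) → flip i (flip i x) ≡ x
flip-involutive i x =
  trans (updateAt-updateAt i x) (updateAt-id-local i x (not-involutive (lookup x i)))

flip-≢ : ∀ {n} (i : Fin n) (x : State n) → flip i x ≢ x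
flip-≢ i x eq = not-¬ refl (sym (trans (sym (lookup-flip i x)) (cong (λ y → lookup y i) eq)))

flip-step : ∀ {n} (D : Mode) (f : BN n) (x : State n) (i : Fin n) →
  lookup (f x) i ≢ lookup x i → Trans D f x (flip i x)
flip-step AD f x i fx≢x = i , fx≢x , refl
flip-step GD f x i fx≢x = flip-≢ i x , agrees
  where
  agrees : ∀ j → lookup (flip i x) j ≢ lookup x j → lookup (flip i x) j ≡ lookup (f x) j
  agrees j changed with j ≟ᶠ i
  ... | yes refl = trans (lookup-flip i x) (sym (¬-not fx≢x))
  ... | no j≢i   = contradiction (lookup∘updateAt′ j i j≢i x) changed

¬autoregulated⇒flip-invariant : ∀ {n} (f : BN n) (i : Fin n) → ¬ Regulates f i i →
  ∀ x → lookup (f x) i ≡ lookup (f (flip i x)) i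
¬autoregulated⇒flip-invariant f i ¬reg x with lookup (f x) i ≟ᵇ lookup (f (flip i x)) i
... | yes eq = eq
... | no neq = contradiction (x , neq) ¬reg

trapSets-meet-across-flip : ∀ {n} (D : Mode) (f : BN n) (i : Fin n) → ¬ Regulates f i i →
  (A B : StateSet n) → TrapSet D f A → TrapSet D f B →
  ∀ x → A x → B (flip i x) → Nonempty (A ∩ B)
trapSets-meet-across-flip D f i ¬reg A B trapA trapB x Ax Bx̄
  with lookup (f x) i ≟ᵇ lookup x i
... | no fx≢x = flip i x , trapA x (flip i x) Ax (flip-step D f x i fx≢x) , Bx̄
... | yes fx≡x = x , Ax , subst B (flip-involutive i x) Bx̄̄
  where
  fx̄≢x̄ : lookup (f (flip i x)) i ≢ lookup (flip i x) i
  fx̄≢x̄ eq = not-¬ refl (begin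
    lookup x i                ≡⟨ sym fx≡x ⟩
    lookup (f x) i            ≡⟨ ¬autoregulated⇒flip-invariant f i ¬reg x ⟩
    lookup (f (flip i x)) i   ≡⟨ eq ⟩
    lookup (flip i x) i       ≡⟨ lookup-flip i x ⟩
    not (lookup x i)          ∎)
    where open ≡-Reasoning
  Bx̄̄ : B (flip i (flip i x))
  Bx̄̄ = trapB (flip i x) _ Bx̄ (flip-step D f (flip i x) i fx̄≢x̄)

init-flip-last : ∀ n (x : Vec Bool (suc n)) → init (flip (fromℕ n) x) ≡ init x
init-flip-last zero    (a ∷ [])  = refl
init-flip-last (suc n) (a ∷ xs) = cong (a ∷_) (init-flip-last n xs)

init-last-injective : ∀ n (x y : Vec Bool (suc n)) → init x ≡ init y →
  lookup x (fromℕ n) ≡ lookup y (fromℕ n) → x ≡ y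
init-last-injective zero    (a ∷ [])  (b ∷ [])  _       eqLast = cong (_∷ []) eqLast
init-last-injective (suc n) (a ∷ xs) (b ∷ ys) eqInit eqLast =
  cong₂ _∷_ (proj₁ (∷-injective eqInit))
            (init-last-injective n xs ys (proj₂ (∷-injective eqInit)) eqLast)

same-init⇒≡∨flip-last : ∀ n (x y : State (suc n)) → init x ≡ init y →
  y ≡ x ⊎ y ≡ flip (fromℕ n) x
same-init⇒≡∨flip-last n x y eqInit with lookup y (fromℕ n) ≟ᵇ lookup x (fromℕ n)
... | yes eqLast = inj₁ (init-last-injective n y x (sym eqInit) eqLast)
... | no neqLast = inj₂ (init-last-injective n y (flip (fromℕ n) x)
                           (trans (sym eqInit) (sym (init-flip-last n x)))
                           (trans (¬-not neqLast) (sym (lookup-flip (fromℕ n) x))))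

attractors-meeting⇒equal : ∀ {n} (D : Mode) (f : BN n) (A B : StateSet n) →
  Attractor D f A → Attractor D f B → Nonempty (A ∩ B) → (A ⊆ B) × (B ⊆ A)
attractors-meeting⇒equal D f A B (_ , trapA , minA) (_ , trapB , minB) meet =
  (λ x Ax → proj₂ (A⊆A∩B x Ax)) , (λ x Bx → proj₁ (B⊆A∩B x Bx))
  where
  trapA∩B : TrapSet D f (A ∩ B)
  trapA∩B x y (Ax , Bx) x→y = trapA x y Ax x→y , trapB x y Bx x→y
  A⊆A∩B : A ⊆ (A ∩ B)
  A⊆A∩B = minA (A ∩ B) meet trapA∩B (λ _ → proj₁)
  B⊆A∩B : B ⊆ (A ∩ B)
  B⊆A∩B = minB (A ∩ B) meet trapA∩B (λ _ → proj₂)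

attractor-⊆-Star⇒equal : (n : ℕ) (f : BN (suc n)) (D : Mode) →
  ¬ Regulates f (fromℕ n) (fromℕ n) →
  (A B : StateSet (suc n)) → Attractor D f A → Attractor D f B → B ⊆ Star A →
  (A ⊆ B) × (B ⊆ A)
attractor-⊆-Star⇒equal n f D ¬reg A B atA@(_ , trapA , _) atB@((b , Bb) , trapB , _) B⊆A* =
  attractors-meeting⇒equal D f A B atA atB meet
  where
  meet : Nonempty (A ∩ B)
  meet with B⊆A* b Bb
  ... | a , Aa , eqInit with same-init⇒≡∨flip-last n a b eqInit
  ...   | inj₁ b≡a = a , Aa , subst B b≡a Bb
  ...   | inj₂ b≡ā =
    trapSets-meet-across-flip D f (fromℕ n) ¬reg A B trapA trapB a Aa (subst B b≡ā Bb)

lemma3 : (n : ℕ) (f : BN (suc n)) (D : Mode) →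
    ¬ Regulates f (fromℕ n) (fromℕ n) →
    (A : StateSet (suc n)) → Attractor D f A →
    (B C : StateSet (suc n)) →
    Attractor D f B → B ⊆ Star A →
    Attractor D f C → C ⊆ Star A →
    (B ⊆ C) × (C ⊆ B)
lemma3 n f D ¬reg A atA B C atB B⊆A* atC C⊆A*
  with attractor-⊆-Star⇒equal n f D ¬reg A B atA atB B⊆A*
     | attractor-⊆-Star⇒equal n f D ¬reg A C atA atC C⊆A*
... | A⊆B , B⊆A | A⊆C , C⊆A = (λ x Bx → A⊆C x (B⊆A x Bx)) , (λ x Cx → A⊆B x (C⊆A x Cx))
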